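{- Let $D=(V,A)$ be a DAG, let $A'\subseteq A$ be a set of minimum size such that $D'=D-A'$ is a funnel, and let $L^*$ be a funnel labeling of $D'$. Then, for any choices made in the procedure ArcDeletionSet, the output $B=\mathrm{ArcDeletionSet}(D,L^*)$ satisfies $|B|=|A'|$.
   Context: A source is a vertex of in-degree $0$, a sink a vertex of out-degree $0$. In a DAG, an arc is private if exactly one directed source-to-sink path contains it. A funnel is a finite DAG in which every directed source-to-sink path contains at least one private arc. An F/M-labeling of a DAG with vertex set $V$ is a function $L:V\to\{F,M\}$. A funnel labeling of a funnel $D'$ is an F/M-labeling $L$ such that the $F$-labeled vertices form the out-forest part and the $M$-labeled vertices the in-forest part of $D'$: every vertex with label $F$ has in-degree at most $1$ in $D'$, every vertex with label $M$ has out-degree at most $1$ in $D'$, and $D'$ has no arc $(v,u)$ with $L(v)=M$ and $L(u)=F$. The procedure ArcDeletionSet$(D,L)$ on a DAG $D$ and F/M-labeling $L$ starts with $B=\emptyset$ and, for every vertex $v$: if $L(v)=M$, it chooses an arbitrary out-neighbor $u$ of $v$ with $L(u)=M$ (if one exists) and adds to $B$ all arcs $(v,w)$ with $w$ an out-neighbor of $v$, $w\ne u$; if $L(v)=F$, it chooses an arbitrary in-neighbor $u$ of $v$ with $L(u)=F$ (if one exists) and adds to $B$ all arcs $(w,v)$ with $w$ an in-neighbor of $v$, $w\ne u$. It returns $B$. (If no such $u$ exists, all out-arcs, resp. in-arcs, of $v$ are added.) -}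

module Defs where

open import Data.Nat using (ℕ; zero; suc; _+_; _≤_)
open import Data.Fin using (Fin; zero; suc; _≟_)
open import Data.Bool using (Bool; true; false; _∧_; _∨_; not; if_then_else_)
open import Data.List using (List; []; _∷_)
open import Data.Maybe using (Maybe; just; nothing)
open import Data.Product using (Σ; _×_; _,_)
open import Data.Sum using (_⊎_)
open import Relation.Binary.PropositionalEquality using (_≡_; _≢_)
open import Relation.Nullary using (¬_)
open import Relation.Nullary.Decidable using (⌊_⌋)

Graph : ℕ → Set
Graph n = Fin n → Fin n → Bool

ArcSet : ℕ → Set
ArcSet = Graph

Arc : ∀ {n} → Graph n → Fin n → Fin n → Set
Arc G u v = G u v ≡ true

count : ∀ {n} → (Fin n → Bool) → ℕ
count {zero}  p = 0
count {suc n} p = (if p zero then 1 else 0) + count (λ i → p (suc i))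

sumRows : ∀ {m n} → (Fin m → Fin n → Bool) → ℕ
sumRows {zero}  B = 0
sumRows {suc m} B = count (B zero) + sumRows (λ i → B (suc i))

size : ∀ {n} → ArcSet n → ℕ
size B = sumRows B

indeg : ∀ {n} → Graph n → Fin n → ℕ
indeg G v = count (λ u → G u v)

outdeg : ∀ {n} → Graph n → Fin n → ℕ
outdeg G v = count (λ u → G v u)

_⊆_ : ∀ {n} → ArcSet n → ArcSet n → Set
B ⊆ A = ∀ u v → B u v ≡ true → A u v ≡ true

_－_ : ∀ {n} → Graph n → ArcSet n → Graph n
(D － B) u v = D u v ∧ not (B u v)

data Path {n} (G : Graph n) : Fin n → Fin n → List (Fin n) → Set where
  one  : ∀ {u v} → Arc G u v → Path G u v (u ∷ v ∷ [])
  cons : ∀ {u v w vs} → Arc G u v → Path G v w vs → Path G u w (u ∷ vs)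

data HasArc {n} (x y : Fin n) : List (Fin n) → Set where
  here  : ∀ {vs} → HasArc x y (x ∷ y ∷ vs)
  there : ∀ {v vs} → HasArc x y vs → HasArc x y (v ∷ vs)

Acyclic : ∀ {n} → Graph n → Set
Acyclic G = ∀ v vs → ¬ Path G v v vs

Source : ∀ {n} → Graph n → Fin n → Set
Source G v = ∀ u → ¬ Arc G u v

Sink : ∀ {n} → Graph n → Fin n → Set
Sink G v = ∀ u → ¬ Arc G v u

-- a directed source-to-sink path (in a DAG every walk is a path)
STPath : ∀ {n} → Graph n → List (Fin n) → Set
STPath G vs = Σ _ λ u → Σ _ λ w → Path G u w vs × Source G u × Sink G w

Private : ∀ {n} → Graph n → Fin n → Fin n → Set
Private G x y =
  Arc G x y ×
  Σ (List _) λ vs → STPath G vs × HasArc x y vs ×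
    (∀ ws → STPath G ws → HasArc x y ws → ws ≡ vs)

Funnel : ∀ {n} → Graph n → Set
Funnel G = Acyclic G ×
  (∀ vs → STPath G vs → Σ _ λ x → Σ _ λ y → HasArc x y vs × Private G x y)

data Label : Set where
  F M : Label

isF isM : Label → Bool
isF F = true
isF M = false
isM F = false
isM M = true

FunnelLabeling : ∀ {n} → Graph n → (Fin n → Label) → Set
FunnelLabeling G L =
  (∀ v → L v ≡ F → indeg G v ≤ 1) ×
  (∀ v → L v ≡ M → outdeg G v ≤ 1) ×
  (∀ v u → L v ≡ M → L u ≡ F → ¬ Arc G v u)

-- A record of the arbitrary choices made by ArcDeletionSet(D, L):
-- c v = just u is the chosen neighbour u of v, nothing if none exists.
ValidChoice : ∀ {n} → Graph n → (Fin n → Label) → (Fin n → Maybe (Fin n)) → Set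
ValidChoice D L c = ∀ v →
  (L v ≡ M →
     (c v ≡ nothing × (∀ u → Arc D v u → L u ≢ M)) ⊎
     (Σ _ λ u → c v ≡ just u × Arc D v u × L u ≡ M)) ×
  (L v ≡ F →
     (c v ≡ nothing × (∀ u → Arc D u v → L u ≢ F)) ⊎
     (Σ _ λ u → c v ≡ just u × Arc D u v × L u ≡ F))

chosen : ∀ {n} → Maybe (Fin n) → Fin n → Bool
chosen nothing  w = false
chosen (just u) w = ⌊ u ≟ w ⌋

ArcDeletionSet : ∀ {n} → Graph n → (Fin n → Label) → (Fin n → Maybe (Fin n)) → ArcSet n
ArcDeletionSet D L c x y =
  D x y ∧ ((isM (L x) ∧ not (chosen (c x) y)) ∨ (isF (L y) ∧ not (chosen (c y) x)))

-- |B| ≥ |A'|: the choices make every F-vertex keep at most its chosen in-arc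
-- and every M-vertex at most its chosen out-arc, and an M-vertex never keeps
-- an arc into an F-vertex; so L is a funnel labeling of D - B.  A DAG with a
-- funnel labeling is a funnel: on every source-to-sink path the first arc
-- entering an M-vertex (or the last arc) leaves an F-vertex (or the source)
-- and enters an M-vertex (or the sink), and such an arc is private, because
-- the walk from a source back to an F-vertex and the walk from an M-vertex
-- forward to a sink are unique.  Minimality of A' then gives |A'| ≤ |B|.
--
-- |B| ≤ |A'|: count the arcs of B leaving M-vertices row by row and those
-- leaving F-vertices (which all enter F-vertices) column by column.  An
-- M-vertex x with a chosen out-neighbour loses all its other out-arcs in B,
-- while A' must delete all but at most one of them since x is an M-vertex of
-- D - A'; if x has no M-labelled out-neighbour, all its out-arcs enter
-- F-vertices and so lie in A'.  Symmetrically for the in-arcs of an F-vertex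
-- coming from F-vertices.

module Submission where

open import Defs
open import Data.Bool using (Bool; true; false; _∧_; _∨_; not; if_then_else_)
open import Data.Empty using (⊥-elim)
open import Data.Fin using (Fin; zero; suc; _≟_)
open import Data.Fin.Properties using (suc-injective; 0≢1+n)
open import Data.List using (List; []; _∷_; _++_; _∷ʳ_)
open import Data.Maybe using (Maybe; just)
open import Data.Nat using (ℕ; zero; suc; _+_; _≤_; _<_; z≤n; s≤s)
open import Data.Nat.Properties
  using (≤-refl; ≤-trans; ≤-reflexive; ≤-antisym; ≤-pred; m≤n+m; +-mono-≤; +-monoˡ-≤; +-mono-≤-<;
         +-suc; +-assoc; +-commutativeSemigroup; module ≤-Reasoning)
open import Algebra.Properties.CommutativeSemigroup +-commutativeSemigroup using (interchange)
open import Data.Product using (Σ; _×_; _,_; proj₁; proj₂)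
open import Data.Sum using (_⊎_; inj₁; inj₂)
open import Function using (_∘_)
open import Relation.Binary.PropositionalEquality
  using (_≡_; _≢_; refl; sym; trans; cong; cong₂; module ≡-Reasoning)
open import Relation.Nullary using (¬_; yes; no)

indicator-mono : ∀ {a b} → (a ≡ true → b ≡ true) → (if a then 1 else 0) ≤ (if b then 1 else 0)
indicator-mono {false}         _   = z≤n
indicator-mono {true}  {true}  _   = ≤-refl
indicator-mono {true}  {false} a⇒b with () ← a⇒b refl

indicator-∨ : ∀ {a b c} → (a ≡ true → b ≡ true ⊎ c ≡ true) →
  (if a then 1 else 0) ≤ (if b then 1 else 0) + (if c then 1 else 0)
indicator-∨ {false}                 _ = z≤n
indicator-∨ {true}  {true}          _ = s≤s z≤n
indicator-∨ {true}  {false} {true}  _ = s≤s z≤n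
indicator-∨ {true}  {false} {false} a⇒b∨c with a⇒b∨c refl
... | inj₁ ()
... | inj₂ ()

count-mono : ∀ {n} {p q : Fin n → Bool} → (∀ i → p i ≡ true → q i ≡ true) → count p ≤ count q
count-mono {zero}  p⇒q = z≤n
count-mono {suc n} p⇒q = +-mono-≤ (indicator-mono (p⇒q zero)) (count-mono (p⇒q ∘ suc))

count-mono-< : ∀ {n} {p q : Fin n → Bool} → (∀ i → p i ≡ true → q i ≡ true) →
  ∀ u → q u ≡ true → p u ≢ true → count p < count q
count-mono-< {suc n} {p} p⇒q zero qu ¬pu with p zero
... | true  = ⊥-elim (¬pu refl)
... | false rewrite qu = s≤s (count-mono (p⇒q ∘ suc))
count-mono-< {suc n} p⇒q (suc u) qu ¬pu =
  +-mono-≤-< (indicator-mono (p⇒q zero)) (count-mono-< (p⇒q ∘ suc) u qu ¬pu)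

count-∨ : ∀ {n} {p q r : Fin n → Bool} → (∀ i → p i ≡ true → q i ≡ true ⊎ r i ≡ true) →
  count p ≤ count q + count r
count-∨ {zero}          p⇒q∨r = z≤n
count-∨ {suc n} {q = q} {r} p⇒q∨r =
  ≤-trans (+-mono-≤ (indicator-∨ (p⇒q∨r zero)) (count-∨ (p⇒q∨r ∘ suc)))
          (≤-reflexive (interchange (if q zero then 1 else 0) (if r zero then 1 else 0) _ _))

count-pos : ∀ {n} {p : Fin n → Bool} i → p i ≡ true → 1 ≤ count p
count-pos {suc n} zero    pi rewrite pi = s≤s z≤n
count-pos {suc n} (suc i) pi = ≤-trans (count-pos i pi) (m≤n+m _ _)

count-≤1⇒unique : ∀ {n} {p : Fin n → Bool} → count p ≤ 1 →
  ∀ i j → p i ≡ true → p j ≡ true → i ≡ j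
count-≤1⇒unique {suc n} ≤1 zero    zero    _  _  = refl
count-≤1⇒unique {suc n} ≤1 zero    (suc j) pi pj rewrite pi with () ← ≤-trans (count-pos j pj) (≤-pred ≤1)
count-≤1⇒unique {suc n} ≤1 (suc i) zero    pi pj rewrite pj with () ← ≤-trans (count-pos i pi) (≤-pred ≤1)
count-≤1⇒unique {suc n} ≤1 (suc i) (suc j) pi pj =
  cong suc (count-≤1⇒unique (≤-trans (m≤n+m _ _) ≤1) i j pi pj)

count-none : ∀ {n} {p : Fin n → Bool} → (∀ i → p i ≢ true) → count p ≡ 0
count-none {zero}      ¬p = refl
count-none {suc n} {p} ¬p with p zero in p0
... | true  = ⊥-elim (¬p zero p0)
... | false = count-none (¬p ∘ suc)

unique⇒count-≤1 : ∀ {n} {p : Fin n → Bool} → (∀ i j → p i ≡ true → p j ≡ true → i ≡ j) → count p ≤ 1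
unique⇒count-≤1 {zero}      unique = z≤n
unique⇒count-≤1 {suc n} {p} unique with p zero in p0
... | true  rewrite count-none (λ i pi → 0≢1+n (unique zero (suc i) p0 pi)) = ≤-refl
... | false = unique⇒count-≤1 (λ i j pi pj → suc-injective (unique (suc i) (suc j) pi pj))

isM∧-count-mono : ∀ {n l} {p q : Fin n → Bool} → (l ≡ M → count p ≤ count q) →
  count (λ i → isM l ∧ p i) ≤ count (λ i → isM l ∧ q i)
isM∧-count-mono {l = M} p≤q = p≤q refl
isM∧-count-mono {l = F} _   = ≤-refl

sumRows-mono : ∀ {m n} {B C : Fin m → Fin n → Bool} →
  (∀ x → count (B x) ≤ count (C x)) → sumRows B ≤ sumRows C
sumRows-mono {zero}  B≤C = z≤n
sumRows-mono {suc m} B≤C = +-mono-≤ (B≤C zero) (sumRows-mono (B≤C ∘ suc))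

count-split : ∀ {n} (p q : Fin n → Bool) →
  count p ≡ count (λ i → q i ∧ p i) + count (λ i → not (q i) ∧ p i)
count-split {zero}  p q = refl
count-split {suc n} p q with q zero
... | true  = trans (cong ((if p zero then 1 else 0) +_) (count-split (p ∘ suc) (q ∘ suc)))
                    (sym (+-assoc (if p zero then 1 else 0) _ _))
... | false with p zero
...   | true  = trans (cong suc (count-split (p ∘ suc) (q ∘ suc))) (sym (+-suc _ _))
...   | false = count-split (p ∘ suc) (q ∘ suc)

sumRows-split : ∀ {m n} (B q : Fin m → Fin n → Bool) →
  sumRows B ≡ sumRows (λ x y → q x y ∧ B x y) + sumRows (λ x y → not (q x y) ∧ B x y)
sumRows-split {zero}  B q = refl
sumRows-split {suc m} B q =
  trans (cong₂ _+_ (count-split (B zero) (q zero)) (sumRows-split (B ∘ suc) (q ∘ suc)))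
        (interchange (count (λ y → q zero y ∧ B zero y)) (count (λ y → not (q zero y) ∧ B zero y)) _ _)

sumRows-noColumns : ∀ {m} (B : Fin m → Fin 0 → Bool) → sumRows B ≡ 0
sumRows-noColumns {zero}  B = refl
sumRows-noColumns {suc m} B = sumRows-noColumns (B ∘ suc)

sumRows-firstColumn : ∀ {m n} (B : Fin m → Fin (suc n) → Bool) →
  sumRows B ≡ count (λ x → B x zero) + sumRows (λ x y → B x (suc y))
sumRows-firstColumn {zero}  B = refl
sumRows-firstColumn {suc m} B =
  trans (cong (count (B zero) +_) (sumRows-firstColumn (B ∘ suc)))
        (interchange (if B zero zero then 1 else 0) (count (λ y → B zero (suc y))) _ _)

sumRows-transpose : ∀ {m n} (B : Fin m → Fin n → Bool) → sumRows B ≡ sumRows (λ y x → B x y)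
sumRows-transpose {zero}  B = sym (sumRows-noColumns (λ y x → B x y))
sumRows-transpose {suc m} B =
  trans (cong (count (B zero) +_) (sumRows-transpose (B ∘ suc)))
        (sym (sumRows-firstColumn (λ y x → B x y)))

module _ {n : ℕ} where

  －-⊆ : (D B : ArcSet n) → (D － B) ⊆ D
  －-⊆ D B u v uv with D u v
  ... | true = refl

  －-cover : ∀ {D B : ArcSet n} {u v} → Arc D u v → Arc (D － B) u v ⊎ Arc B u v
  －-cover {B = B} {u} {v} uv with B u v
  ... | true  = inj₂ refl
  ... | false = inj₁ (cong (_∧ true) uv)

  Path-mono : ∀ {G H : Graph n} {u w vs} → G ⊆ H → Path G u w vs → Path H u w vs
  Path-mono G⊆H (one uv)    = one (G⊆H _ _ uv)
  Path-mono G⊆H (cons uv p) = cons (G⊆H _ _ uv) (Path-mono G⊆H p)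

  Acyclic-anti : ∀ {G H : Graph n} → G ⊆ H → Acyclic H → Acyclic G
  Acyclic-anti G⊆H acyclic v vs = acyclic v vs ∘ Path-mono G⊆H

data Walk {n} (G : Graph n) : Fin n → Fin n → List (Fin n) → Set where
  []  : ∀ {u} → Walk G u u (u ∷ [])
  _∷_ : ∀ {u v w vs} → Arc G u v → Walk G v w vs → Walk G u w (u ∷ vs)

data SnocWalk {n} (G : Graph n) : Fin n → Fin n → List (Fin n) → Set where
  []   : ∀ {u} → SnocWalk G u u (u ∷ [])
  _▷_  : ∀ {u v w vs} → SnocWalk G u v vs → Arc G v w → SnocWalk G u w (vs ∷ʳ w)

module _ {n : ℕ} {G : Graph n} where

  SnocWalk-cons : ∀ {u v w vs} → Arc G u v → SnocWalk G v w vs → SnocWalk G u w (u ∷ vs)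
  SnocWalk-cons uv []       = [] ▷ uv
  SnocWalk-cons uv (p ▷ vw) = SnocWalk-cons uv p ▷ vw

  Path⇒Walk : ∀ {u w vs} → Path G u w vs → Walk G u w vs
  Path⇒Walk (one uv)    = uv ∷ []
  Path⇒Walk (cons uv p) = uv ∷ Path⇒Walk p

  Path-splitAt : ∀ {u w vs x y} → Path G u w vs → HasArc x y vs →
    Σ _ λ ps → Σ _ λ qs → SnocWalk G u x ps × Arc G x y × Walk G y w qs × vs ≡ ps ++ qs
  Path-splitAt (one xy)               here = _ , _ , [] , xy , [] , refl
  Path-splitAt (one _)                (there (there ()))
  Path-splitAt (cons xy p@(one _))    here = _ , _ , [] , xy , Path⇒Walk p , refl
  Path-splitAt (cons xy p@(cons _ _)) here = _ , _ , [] , xy , Path⇒Walk p , refl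
  Path-splitAt (cons uv p)            (there xy∈vs) with Path-splitAt p xy∈vs
  ... | ps , qs , pre , xy , suf , vs≡ = _ , qs , SnocWalk-cons uv pre , xy , suf , cong (_ ∷_) vs≡

  SnocWalk-toSource : ∀ {u x vs} → Source G x → SnocWalk G u x vs → vs ≡ x ∷ []
  SnocWalk-toSource source []       = refl
  SnocWalk-toSource source (_ ▷ vx) = ⊥-elim (source _ vx)

  Walk-fromSink : ∀ {y w vs} → Sink G y → Walk G y w vs → vs ≡ y ∷ []
  Walk-fromSink sink []       = refl
  Walk-fromSink sink (yv ∷ _) = ⊥-elim (sink _ yv)

  Path-headArc : ∀ {u v w vs} → Path G v w vs → HasArc u v (u ∷ vs)
  Path-headArc (one _)    = here
  Path-headArc (cons _ _) = here

module _ {n : ℕ} {G : Graph n} {L : Fin n → Label} (labeling : FunnelLabeling G L) where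

  private
    indeg≤1 : ∀ v → L v ≡ F → indeg G v ≤ 1
    indeg≤1 = proj₁ labeling

    outdeg≤1 : ∀ v → L v ≡ M → outdeg G v ≤ 1
    outdeg≤1 = proj₁ (proj₂ labeling)

    no-M→F : ∀ v u → L v ≡ M → L u ≡ F → ¬ Arc G v u
    no-M→F = proj₂ (proj₂ labeling)

  inNeighbour-F : ∀ {x y} → L y ≡ F → Arc G x y → L x ≡ F
  inNeighbour-F {x} Ly xy with L x in Lx
  ... | F = refl
  ... | M = ⊥-elim (no-M→F _ _ Lx Ly xy)

  outNeighbour-M : ∀ {x y} → L x ≡ M → Arc G x y → L y ≡ M
  outNeighbour-M {y = y} Lx xy with L y in Ly
  ... | M = refl
  ... | F = ⊥-elim (no-M→F _ _ Lx Ly xy)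

  SnocWalk-unique : ∀ {s s' x ps qs} → L x ≡ F ⊎ Source G x → Source G s → Source G s' →
    SnocWalk G s x ps → SnocWalk G s' x qs → ps ≡ qs
  SnocWalk-unique (inj₂ x-source) _ _ p q =
    trans (SnocWalk-toSource x-source p) (sym (SnocWalk-toSource x-source q))
  SnocWalk-unique (inj₁ Lx) s s' []       []       = refl
  SnocWalk-unique (inj₁ Lx) s s' []       (_ ▷ vx) = ⊥-elim (s _ vx)
  SnocWalk-unique (inj₁ Lx) s s' (_ ▷ vx) []       = ⊥-elim (s' _ vx)
  SnocWalk-unique {x = x} (inj₁ Lx) s s' (_▷_ {v = v} p vx) (_▷_ {v = v'} q v'x)
    with count-≤1⇒unique (indeg≤1 x Lx) v v' vx v'x
  ... | refl = cong (_∷ʳ x) (SnocWalk-unique (inj₁ (inNeighbour-F Lx vx)) s s' p q)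

  Walk-unique : ∀ {y t t' ps qs} → L y ≡ M ⊎ Sink G y → Sink G t → Sink G t' →
    Walk G y t ps → Walk G y t' qs → ps ≡ qs
  Walk-unique (inj₂ y-sink) _ _ p q = trans (Walk-fromSink y-sink p) (sym (Walk-fromSink y-sink q))
  Walk-unique (inj₁ Ly) t t' []       []       = refl
  Walk-unique (inj₁ Ly) t t' []       (yv ∷ _) = ⊥-elim (t _ yv)
  Walk-unique (inj₁ Ly) t t' (yv ∷ _) []       = ⊥-elim (t' _ yv)
  Walk-unique {y = y} (inj₁ Ly) t t' (_∷_ {v = v} yv p) (_∷_ {v = v'} yv' q)
    with count-≤1⇒unique (outdeg≤1 y Ly) v v' yv yv'
  ... | refl = cong (y ∷_) (Walk-unique (inj₁ (outNeighbour-M Ly yv)) t t' p q)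

  Path-FM-arc : ∀ {u w vs} → L u ≡ F ⊎ Source G u → Path G u w vs → Sink G w →
    Σ _ λ x → Σ _ λ y → HasArc x y vs × (L x ≡ F ⊎ Source G x) × (L y ≡ M ⊎ Sink G y)
  Path-FM-arc u-FS (one _) sink = _ , _ , here , u-FS , inj₂ sink
  Path-FM-arc u-FS (cons {v = v} _ p) sink with L v in Lv
  ... | M = _ , _ , Path-headArc p , u-FS , inj₁ Lv
  ... | F with Path-FM-arc (inj₁ Lv) p sink
  ...   | x , y , xy∈vs , x-FS , y-MS = x , y , there xy∈vs , x-FS , y-MS

  FM-arc-private : ∀ {x y vs} → L x ≡ F ⊎ Source G x → L y ≡ M ⊎ Sink G y →
    STPath G vs → HasArc x y vs → Private G x y
  FM-arc-private x-FS y-MS st@(u , w , p , source , sink) xy∈vs with Path-splitAt p xy∈vs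
  ... | ps , qs , pre , xy , suf , vs≡ = xy , _ , st , xy∈vs , unique
    where
    open ≡-Reasoning
    unique : ∀ ws → STPath G ws → HasArc _ _ ws → ws ≡ _
    unique ws (u' , w' , p' , source' , sink') xy∈ws with Path-splitAt p' xy∈ws
    ... | ps' , qs' , pre' , _ , suf' , ws≡ = begin
      ws         ≡⟨ ws≡ ⟩
      ps' ++ qs' ≡⟨ cong₂ _++_ (SnocWalk-unique x-FS source' source pre' pre)
                               (Walk-unique y-MS sink' sink suf' suf) ⟩
      ps ++ qs   ≡⟨ sym vs≡ ⟩
      _          ∎

  funnelLabeling⇒funnel : Acyclic G → Funnel G
  funnelLabeling⇒funnel acyclic = acyclic , λ where
    vs st@(u , w , p , source , sink) →
      let x , y , xy∈vs , x-FS , y-MS = Path-FM-arc (inj₂ source) p sink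
      in x , y , xy∈vs , FM-arc-private x-FS y-MS st xy∈vs

chosen-just : ∀ {n} {u w : Fin n} → chosen (just u) w ≡ true → u ≡ w
chosen-just {u = u} {w} c≡true with u ≟ w
... | yes u≡w = u≡w
chosen-just () | no _

chosen-self : ∀ {n} (u : Fin n) → chosen (just u) u ≡ true
chosen-self u with u ≟ u
... | yes _  = refl
... | no u≢u = ⊥-elim (u≢u refl)

chosen-unique : ∀ {n} (m : Maybe (Fin n)) {i j} → chosen m i ≡ true → chosen m j ≡ true → i ≡ j
chosen-unique (just u) ci cj = trans (sym (chosen-just ci)) (chosen-just cj)

deleted-cases : ∀ d lx ly cxy cyx → d ∧ ((isM lx ∧ not cxy) ∨ (isF ly ∧ not cyx)) ≡ true →
  d ≡ true × ((lx ≡ M × cxy ≡ false) ⊎ (ly ≡ F × cyx ≡ false))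
deleted-cases true M _ false _     _ = refl , inj₁ (refl , refl)
deleted-cases true _ F _     false _ = refl , inj₂ (refl , refl)
deleted-cases true M M true  _     ()
deleted-cases true M F true  true  ()
deleted-cases true F M _     _     ()
deleted-cases true F F _     true  ()

kept-out-of-M : ∀ d {lx} ly cxy cyx → lx ≡ M →
  d ∧ not (d ∧ ((isM lx ∧ not cxy) ∨ (isF ly ∧ not cyx))) ≡ true → cxy ≡ true
kept-out-of-M true _ true  _ refl _ = refl
kept-out-of-M true _ false _ refl ()

kept-into-F : ∀ d lx {ly} cxy cyx → ly ≡ F →
  d ∧ not (d ∧ ((isM lx ∧ not cxy) ∨ (isF ly ∧ not cyx))) ≡ true → cyx ≡ true
kept-into-F true _ _     true  refl _ = refl
kept-into-F true M false false refl ()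
kept-into-F true M true  false refl ()
kept-into-F true F _     false refl ()

F-tail : ∀ {l b} → not (isM l) ∧ b ≡ true → l ≡ F × b ≡ true
F-tail {F} b≡true = refl , b≡true

F-tail⁻ : ∀ {l b} → l ≡ F → b ≡ true → not (isM l) ∧ b ≡ true
F-tail⁻ refl b≡true = b≡true

Label-cases : ∀ l → l ≡ M ⊎ l ≡ F
Label-cases M = inj₁ refl
Label-cases F = inj₂ refl

≢M⇒≡F : ∀ {l} → l ≢ M → l ≡ F
≢M⇒≡F {F} _   = refl
≢M⇒≡F {M} l≢M = ⊥-elim (l≢M refl)

module ArcDeletion {n : ℕ} (D : Graph n) (L : Fin n → Label)
                   (c : Fin n → Maybe (Fin n)) (valid : ValidChoice D L c) where

  B : ArcSet n
  B = ArcDeletionSet D L c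

  B⊆D : B ⊆ D
  B⊆D x y Bxy = proj₁ (deleted-cases (D x y) (L x) (L y) (chosen (c x) y) (chosen (c y) x) Bxy)

  deleted : ∀ {x y} → Arc B x y →
    (L x ≡ M × chosen (c x) y ≡ false) ⊎ (L y ≡ F × chosen (c y) x ≡ false)
  deleted {x} {y} Bxy = proj₂ (deleted-cases (D x y) (L x) (L y) (chosen (c x) y) (chosen (c y) x) Bxy)

  F→M-undeleted : ∀ {x y} → L x ≡ F → L y ≡ M → ¬ Arc B x y
  F→M-undeleted {x} {y} Lx Ly Bxy with deleted {x} {y} Bxy
  ... | inj₁ (Lx≡M , _) with () ← trans (sym Lx) Lx≡M
  ... | inj₂ (Ly≡F , _) with () ← trans (sym Ly) Ly≡F

  kept-chosenOut : ∀ {x y} → L x ≡ M → Arc (D － B) x y → chosen (c x) y ≡ true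
  kept-chosenOut {x} {y} = kept-out-of-M (D x y) (L y) (chosen (c x) y) (chosen (c y) x)

  kept-chosenIn : ∀ {x y} → L y ≡ F → Arc (D － B) x y → chosen (c y) x ≡ true
  kept-chosenIn {x} {y} = kept-into-F (D x y) (L x) (chosen (c x) y) (chosen (c y) x)

  kept-no-M→F : ∀ x y → L x ≡ M → L y ≡ F → ¬ Arc (D － B) x y
  kept-no-M→F x y Lx Ly kept with proj₁ (valid x) Lx | kept-chosenOut Lx kept
  ... | inj₁ (cx≡nothing , _) | chosen-y rewrite cx≡nothing with () ← chosen-y
  ... | inj₂ (u , cx≡u , _ , Lu) | chosen-y rewrite cx≡u with refl ← chosen-just chosen-y
    with () ← trans (sym Lu) Ly

  kept-funnelLabeling : FunnelLabeling (D － B) L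
  kept-funnelLabeling =
      (λ y Ly → unique⇒count-≤1 λ _ _ i j → chosen-unique (c y) (kept-chosenIn Ly i) (kept-chosenIn Ly j))
    , (λ x Lx → unique⇒count-≤1 λ _ _ i j → chosen-unique (c x) (kept-chosenOut Lx i) (kept-chosenOut Lx j))
    , kept-no-M→F

  module _ (A' : ArcSet n) (labeling : FunnelLabeling (D － A') L) where

    M→F-in-A' : ∀ {x y} → L x ≡ M → L y ≡ F → Arc D x y → Arc A' x y
    M→F-in-A' {x} {y} Lx Ly xy with －-cover {D = D} {A'} xy
    ... | inj₁ kept = ⊥-elim (proj₂ (proj₂ labeling) x y Lx Ly kept)
    ... | inj₂ A'xy = A'xy

    deleted-outArcs≤ : ∀ x → L x ≡ M → count (B x) ≤ count (A' x)
    deleted-outArcs≤ x Lx with proj₁ (valid x) Lx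
    ... | inj₁ (_ , no-M-out) =
      count-mono λ y Bxy → let xy = B⊆D x y Bxy in M→F-in-A' Lx (≢M⇒≡F (no-M-out y xy)) xy
    ... | inj₂ (u , cx≡u , xu , Lu) = ≤-pred (begin-strict
      count (B x)                              <⟨ count-mono-< (B⊆D x) u xu B∌xu ⟩
      count (D x)                              ≤⟨ count-∨ (λ y → －-cover {D = D} {A'} {x} {y}) ⟩
      count ((D － A') x) + count (A' x)       ≤⟨ +-monoˡ-≤ _ (proj₁ (proj₂ labeling) x Lx) ⟩
      suc (count (A' x))                       ∎)
      where
      open ≤-Reasoning
      B∌xu : ¬ Arc B x u
      B∌xu Bxu with deleted {x} {u} Bxu
      ... | inj₁ (_ , ¬chosen) rewrite cx≡u | chosen-self u with () ← ¬chosen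
      ... | inj₂ (Lu≡F , _) with () ← trans (sym Lu) Lu≡F

    M-outArcs F-inArcs : ArcSet n → Fin n → Fin n → Bool
    M-outArcs C x y = isM (L x) ∧ C x y
    F-inArcs  C y x = not (isM (L x)) ∧ C x y

    deleted-F-inArcs≤ : ∀ y → count (F-inArcs B y) ≤ count (F-inArcs A' y)
    deleted-F-inArcs≤ y with Label-cases (L y)
    ... | inj₁ Ly = count-mono {p = F-inArcs B y} λ x FBxy →
            let Lx , Bxy = F-tail FBxy in ⊥-elim (F→M-undeleted Lx Ly Bxy)
    ... | inj₂ Ly with proj₂ (valid y) Ly
    ...   | inj₁ (_ , no-F-in) = count-mono {p = F-inArcs B y} λ x FBxy →
              let Lx , Bxy = F-tail FBxy in ⊥-elim (no-F-in x (B⊆D x y Bxy) Lx)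
    ...   | inj₂ (u , cy≡u , uy , Lu) = ≤-pred (begin-strict
      count (F-inArcs B y)                                <⟨ count-mono-< B⊆D-F u (F-tail⁻ Lu uy) B∌uy ⟩
      count (F-inArcs D y)                                ≤⟨ count-∨ kept-or-A' ⟩
      count (λ x → (D － A') x y) + count (F-inArcs A' y)  ≤⟨ +-monoˡ-≤ _ (proj₁ labeling y Ly) ⟩
      suc (count (F-inArcs A' y))                         ∎)
      where
      open ≤-Reasoning
      B⊆D-F : ∀ x → F-inArcs B y x ≡ true → F-inArcs D y x ≡ true
      B⊆D-F x FBxy = let Lx , Bxy = F-tail FBxy in F-tail⁻ Lx (B⊆D x y Bxy)
      kept-or-A' : ∀ x → F-inArcs D y x ≡ true → (D － A') x y ≡ true ⊎ F-inArcs A' y x ≡ true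
      kept-or-A' x FDxy with F-tail FDxy
      ... | Lx , xy with －-cover {D = D} {A'} xy
      ...   | inj₁ kept = inj₁ kept
      ...   | inj₂ A'xy = inj₂ (F-tail⁻ Lx A'xy)
      B∌uy : F-inArcs B y u ≢ true
      B∌uy FBuy with deleted {u} {y} (proj₂ (F-tail {L u} FBuy))
      ... | inj₁ (Lu≡M , _) with () ← trans (sym Lu) Lu≡M
      ... | inj₂ (_ , ¬chosen) rewrite cy≡u | chosen-self u with () ← ¬chosen

    size-deleted≤ : size B ≤ size A'
    size-deleted≤ = begin
      size B
        ≡⟨ sumRows-split B (λ x _ → isM (L x)) ⟩
      sumRows (M-outArcs B) + sumRows (λ x y → not (isM (L x)) ∧ B x y)
        ≡⟨ cong (sumRows (M-outArcs B) +_) (sumRows-transpose (λ x y → not (isM (L x)) ∧ B x y)) ⟩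
      sumRows (M-outArcs B) + sumRows (F-inArcs B)
        ≤⟨ +-mono-≤ (sumRows-mono λ x → isM∧-count-mono {p = B x} (deleted-outArcs≤ x))
                    (sumRows-mono deleted-F-inArcs≤) ⟩
      sumRows (M-outArcs A') + sumRows (F-inArcs A')
        ≡⟨ cong (sumRows (M-outArcs A') +_) (sym (sumRows-transpose (λ x y → not (isM (L x)) ∧ A' x y))) ⟩
      sumRows (M-outArcs A') + sumRows (λ x y → not (isM (L x)) ∧ A' x y)
        ≡⟨ sym (sumRows-split A' (λ x _ → isM (L x))) ⟩
      size A' ∎
      where open ≤-Reasoning

proposition1 : (n : ℕ) (D : Graph n) → Acyclic D →
    (A' : ArcSet n) → A' ⊆ D → Funnel (D － A') →
    (∀ (A'' : ArcSet n) → A'' ⊆ D → Funnel (D － A'') → size A' ≤ size A'') →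
    (L : Fin n → Label) → FunnelLabeling (D － A') L →
    (c : Fin n → Maybe (Fin n)) → ValidChoice D L c →
    size (ArcDeletionSet D L c) ≡ size A'
proposition1 n D acyclic A' _ _ minimal L labeling c valid =
  ≤-antisym (size-deleted≤ A' labeling)
            (minimal B B⊆D (funnelLabeling⇒funnel kept-funnelLabeling (Acyclic-anti (－-⊆ D B) acyclic)))
  where open ArcDeletion D L c valid
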